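{- Let $\ell \le m \le n$ be positive integers. Then for all subsets $S \subseteq S_\ell$ and $T \subseteq S_n$, \[ \mathrm{Comp}_n(\mathrm{Comp}_m(S)) = \mathrm{Comp}_n(S), \qquad \mathrm{Pat}_\ell(\mathrm{Pat}_m(T)) = \mathrm{Pat}_\ell(T), \] and for all subgroups $G \le S_\ell$ and $H \le S_n$, \[ \overline{\mathrm{Comp}}_n(\overline{\mathrm{Comp}}_m(G)) = \overline{\mathrm{Comp}}_n(G), \qquad \overline{\mathrm{Pat}}_\ell(\overline{\mathrm{Pat}}_m(H)) = \overline{\mathrm{Pat}}_\ell(H). \]
   Context: $S_n$ denotes the symmetric group on $[n]=\{1,\dots,n\}$ (permutations composed right to left). A permutation $\pi \in S_n$ involves $\tau\in S_\ell$ ($\ell\le n$), or $\tau$ is an $\ell$-pattern of $\pi$, if there are indices $i_1<\dots<i_\ell$ in $[n]$ such that for all $j,k\in[\ell]$, $\pi(i_j)<\pi(i_k)$ iff $\tau(j)<\tau(k)$. For $\pi\in S_n$ let $\mathrm{Pat}_\ell(\pi)$ be the set of its $\ell$-patterns. For $S\subseteq S_\ell$ and $T\subseteq S_n$ with $\ell \le n$: $\mathrm{Comp}_n(S)=\{\tau\in S_n : \mathrm{Pat}_\ell(\tau)\subseteq S\}$, $\mathrm{Pat}_\ell(T)=\bigcup_{\tau\in T}\mathrm{Pat}_\ell(\tau)$, $\overline{\mathrm{Comp}}_n(S)=\langle \mathrm{Comp}_n(S)\rangle$ and $\overline{\mathrm{Pat}}_\ell(T)=\langle \mathrm{Pat}_\ell(T)\rangle$,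 where $\langle\cdot\rangle$ denotes the generated subgroup (of $S_n$, resp. $S_\ell$). -}

module Defs where

open import Data.Nat using (ℕ)
open import Data.Fin using (Fin) renaming (_<_ to _<ᶠ_)
open import Data.Vec using (Vec; lookup; tabulate)
open import Data.Vec.Properties using (lookup∘tabulate)
open import Data.Product using (Σ; ∃; _×_; _,_)
open import Relation.Binary.PropositionalEquality using (_≡_; refl; sym; trans; cong)
open import Function using (id; _⇔_)

-- A permutation of [n] is stored as its one-line notation (a vector of
-- length n listing π(1),…,π(n)), together with an (irrelevant) proof that
-- it is injective, i.e. a bijection of the finite set Fin n.
-- Since the proof field is irrelevant, two permutations are equal iff
-- their one-line notations are equal.
record Perm (n : ℕ) : Set where
  constructor mkPerm
  field
    vec : Vec (Fin n) n
    .inj : ∀ i j → lookup vec i ≡ lookup vec j → i ≡ j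

open Perm public

app : ∀ {n} → Perm n → Fin n → Fin n
app π i = lookup (vec π) i

idP : ∀ {n} → Perm n
idP {n} = mkPerm (tabulate id) λ i j e →
  trans (sym (lookup∘tabulate id i)) (trans e (lookup∘tabulate id j))

_∘ₚ_ : ∀ {n} → Perm n → Perm n → Perm n
mkPerm u p ∘ₚ mkPerm v q =
  mkPerm (tabulate f) λ i j e →
    q i j (p _ _ (trans (sym (lookup∘tabulate f i))
                   (trans e (lookup∘tabulate f j))))
  where
  f : _ → _
  f i = lookup u (lookup v i)

PSet : ℕ → Set₁
PSet n = Perm n → Set

_⊆ₚ_ : ∀ {n} → PSet n → PSet n → Set
A ⊆ₚ B = ∀ π → A π → B π

_≐_ : ∀ {n} → PSet n → PSet n → Set
A ≐ B = (A ⊆ₚ B) × (B ⊆ₚ A)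

IsPatternOf : ∀ {ℓ n} → Perm ℓ → Perm n → Set
IsPatternOf {ℓ} {n} σ π =
  Σ (Fin ℓ → Fin n) λ ι →
    (∀ j k → j <ᶠ k → ι j <ᶠ ι k) ×
    (∀ j k → (app π (ι j) <ᶠ app π (ι k)) ⇔ (app σ j <ᶠ app σ k))

PatOf : ∀ ℓ {n} → Perm n → PSet ℓ
PatOf ℓ π σ = IsPatternOf σ π

Comp : ∀ {ℓ} n → PSet ℓ → PSet n
Comp n S τ = PatOf _ τ ⊆ₚ S

Pat : ∀ ℓ {n} → PSet n → PSet ℓ
Pat ℓ T σ = ∃ λ τ → T τ × IsPatternOf σ τ

-- generated subgroup ⟨A⟩: the least subset containing A and the identity,
-- closed under composition and inverses (inverse expressed relationally:
-- if ρ ∈ ⟨A⟩ and σ ∘ ρ = id then σ ∈ ⟨A⟩).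
data ⟨_⟩ {n : ℕ} (A : PSet n) : PSet n where
  gen  : ∀ {π} → A π → ⟨ A ⟩ π
  one  : ⟨ A ⟩ idP
  mul  : ∀ {σ τ} → ⟨ A ⟩ σ → ⟨ A ⟩ τ → ⟨ A ⟩ (σ ∘ₚ τ)
  inv  : ∀ {σ ρ} → ⟨ A ⟩ ρ → σ ∘ₚ ρ ≡ idP → ⟨ A ⟩ σ

record IsSubgroup {n : ℕ} (G : PSet n) : Set where
  field
    has-id  : G idP
    closed∘ : ∀ σ τ → G σ → G τ → G (σ ∘ₚ τ)
    closed⁻¹ : ∀ σ ρ → G ρ → σ ∘ₚ ρ ≡ idP → G σ

CompBar : ∀ {ℓ} n → PSet ℓ → PSet n
CompBar n S = ⟨ Comp n S ⟩

PatBar : ∀ ℓ {n} → PSet n → PSet ℓ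
PatBar ℓ T = ⟨ Pat ℓ T ⟩

-- An occurrence of σ ∈ S_ℓ in τ ∈ S_n uses only ℓ of the n positions; deleting unused
-- positions one at a time yields ρ ∈ S_m with σ ≼ ρ ≼ τ for every ℓ ≤ m ≤ n. Together with
-- transitivity of ≼ this gives both set identities. For the group identities, the pattern of
-- αβ at positions ι is the product of the pattern of α at the (sorted) positions β(ι)
-- with the pattern of β at ι, and patterns of π⁻¹ are inverses of patterns of π. Hence
-- Comp_n(G) is a subgroup when G is, and Pat_ℓ⟨A⟩ ⊆ ⟨Pat_ℓ(A)⟩.
module Submission where

open import Defs
open import Data.Nat as ℕ using (ℕ; suc; _≤_; z≤n; s≤s)
import Data.Nat.Properties as ℕ
open import Data.Fin using (Fin; zero; suc; toℕ; fromℕ<; inject₁; punchIn; punchOut; _<_; _≟_; _<?_)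
import Data.Fin.Properties as Fin
open import Data.Fin.Subset using (Subset; _∈_; _∉_; ∣_∣)
open import Data.Fin.Subset.Properties using (∈⊤; ⊆⊤; ∣⊤∣≡n; p⊂q⇒∣p∣<∣q∣)
open import Data.Vec using (tabulate)
open import Data.Vec.Properties using (lookup∘tabulate; []=⇒lookup; lookup⇒[]=)
open import Data.Vec.Relation.Binary.Pointwise.Extensional using (ext; Pointwise-≡⇒≡)
open import Data.Bool.Properties using (T-≡)
open import Data.Product using (Σ; ∃; ∃₂; _×_; _,_; proj₁; proj₂)
import Data.Product as Product
open import Data.Sum using (inj₁; inj₂)
open import Function using (_∘_; id; _⇔_; mk⇔; Equivalence)
open import Function.Definitions using (Injective)
open import Function.Properties.Equivalence using (⇔-isEquivalence)
open import Level using (0ℓ)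
open import Relation.Binary.Structures using (IsEquivalence)
open import Relation.Binary.Definitions using (tri<; tri≈; tri>)
open import Relation.Binary.PropositionalEquality
open import Relation.Nullary using (¬_; yes; no; contradiction)
open import Relation.Nullary.Decidable using (isYes; toWitness; fromWitness; recompute)

open Equivalence using (to; from)
open IsEquivalence (⇔-isEquivalence {ℓ = 0ℓ}) using () renaming (refl to ⇔-refl; sym to ⇔-sym; trans to ⇔-trans)

private variable
  a b c d ℓ m n : ℕ

Increasing : (Fin a → Fin b) → Set
Increasing ι = ∀ j k → j < k → ι j < ι k

SameOrder : (Fin a → Fin b) → (Fin a → Fin c) → Set
SameOrder f g = ∀ j k → (f j < f k) ⇔ (g j < g k)

module _ {f : Fin a → Fin b} {g : Fin a → Fin c} where

  sameOrder-sym : SameOrder f g → SameOrder g f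
  sameOrder-sym o j k = ⇔-sym (o j k)

  sameOrder-trans : {h : Fin a → Fin d} → SameOrder f g → SameOrder g h → SameOrder f h
  sameOrder-trans o o′ j k = ⇔-trans (o j k) (o′ j k)

  sameOrder-∘ : (e : Fin d → Fin a) → SameOrder f g → SameOrder (f ∘ e) (g ∘ e)
  sameOrder-∘ e o j k = o (e j) (e k)

  monotone⇒sameOrder : Injective _≡_ _≡_ f → (∀ j k → f j < f k → g j < g k) → SameOrder f g
  monotone⇒sameOrder f-inj mono j k = mk⇔ (mono j k) reflect
    where
    reflect : g j < g k → f j < f k
    reflect gj<gk with Fin.<-cmp (f j) (f k)
    ... | tri< fj<fk _ _ = fj<fk
    ... | tri≈ _ fj≡fk _ = contradiction (cong g (f-inj fj≡fk)) (Fin.<⇒≢ gj<gk)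
    ... | tri> _ _ fk<fj = contradiction gj<gk (Fin.<-asym (mono k j fk<fj))

  sameOrder-injective : Injective _≡_ _≡_ f → SameOrder f g → Injective _≡_ _≡_ g
  sameOrder-injective f-inj o {j} {k} gj≡gk with Fin.<-cmp (f j) (f k)
  ... | tri< fj<fk _ _ = contradiction gj≡gk (Fin.<⇒≢ (to (o j k) fj<fk))
  ... | tri≈ _ fj≡fk _ = f-inj fj≡fk
  ... | tri> _ _ fk<fj = contradiction (sym gj≡gk) (Fin.<⇒≢ (to (o k j) fk<fj))

≗⇒sameOrder : {f g : Fin a → Fin b} → f ≗ g → SameOrder f g
≗⇒sameOrder eq j k rewrite eq j | eq k = ⇔-refl

module SameOrder-Reasoning where

  infixr 2 _~⟨_⟩_ _~⟨_⟨_ _≗⟨_⟩_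
  infix 3 _∎

  _~⟨_⟩_ : (f : Fin a → Fin b) {g : Fin a → Fin c} {h : Fin a → Fin d} →
    SameOrder f g → SameOrder g h → SameOrder f h
  _ ~⟨ f~g ⟩ g~h = sameOrder-trans f~g g~h

  _~⟨_⟨_ : (f : Fin a → Fin b) {g : Fin a → Fin c} {h : Fin a → Fin d} →
    SameOrder g f → SameOrder g h → SameOrder f h
  _ ~⟨ g~f ⟨ g~h = sameOrder-trans (sameOrder-sym g~f) g~h

  _≗⟨_⟩_ : (f : Fin a → Fin b) {g : Fin a → Fin b} {h : Fin a → Fin d} →
    f ≗ g → SameOrder g h → SameOrder f h
  _ ≗⟨ f≗g ⟩ g~h = sameOrder-trans (≗⇒sameOrder f≗g) g~h

  _∎ : (f : Fin a → Fin b) → SameOrder f f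
  _ ∎ = λ _ _ → ⇔-refl

increasing⇒sameOrder : {ι : Fin a → Fin b} → Increasing ι → SameOrder id ι
increasing⇒sameOrder = monotone⇒sameOrder (λ eq → eq)

increasing-injective : {ι : Fin a → Fin b} → Increasing ι → Injective _≡_ _≡_ ι
increasing-injective inc = sameOrder-injective (λ eq → eq) (increasing⇒sameOrder inc)

increasing-≥ : (h : Fin a → Fin b) → Increasing h → ∀ u → toℕ u ≤ toℕ (h u)
increasing-≥ h inc zero = z≤n
increasing-≥ h inc (suc u) = ℕ.≤-<-trans ih (inc (inject₁ u) (suc u) inject₁u<1+u)
  where
  h∘inject₁-increasing : Increasing (h ∘ inject₁)
  h∘inject₁-increasing j k j<k = inc (inject₁ j) (inject₁ k)
    (subst₂ ℕ._<_ (sym (Fin.toℕ-inject₁ j)) (sym (Fin.toℕ-inject₁ k)) j<k)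
  ih : toℕ u ≤ toℕ (h (inject₁ u))
  ih = increasing-≥ (h ∘ inject₁) h∘inject₁-increasing u
  inject₁u<1+u : inject₁ u < suc u
  inject₁u<1+u = s≤s (ℕ.≤-reflexive (Fin.toℕ-inject₁ u))

app-∘ : (σ τ : Perm n) (i : Fin n) → app (σ ∘ₚ τ) i ≡ app σ (app τ i)
app-∘ σ τ = lookup∘tabulate (app σ ∘ app τ)

app-idP : (i : Fin n) → app idP i ≡ i
app-idP = lookup∘tabulate id

perm-ext : {σ τ : Perm n} → app σ ≗ app τ → σ ≡ τ
perm-ext {σ = mkPerm u _} {mkPerm v _} σ≗τ with Pointwise-≡⇒≡ {xs = u} {ys = v} (ext σ≗τ)
... | refl = refl

app-injective : (π : Perm n) → Injective _≡_ _≡_ (app π)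
app-injective (mkPerm _ π-inj) {i} {j} πi≡πj = recompute (i ≟ j) (π-inj i j πi≡πj)

fromInjective : (f : Fin n → Fin n) → Injective _≡_ _≡_ f → Perm n
fromInjective f f-inj = mkPerm (tabulate f) λ i j eq →
  f-inj (trans (sym (lookup∘tabulate f i)) (trans eq (lookup∘tabulate f j)))

app-surjective : (π : Perm n) (v : Fin n) → ∃ λ u → app π u ≡ v
app-surjective {suc n} π v with Fin.any? (λ u → app π u ≟ v)
... | yes hit = hit
... | no miss = contradiction (Fin.injective⇒≤ punched-injective) ℕ.1+n≰n
  where
  v∉image : ∀ u → v ≢ app π u
  v∉image u v≡πu = miss (u , sym v≡πu)
  punched : Fin (suc n) → Fin n
  punched u = punchOut (v∉image u)
  punched-injective : Injective _≡_ _≡_ punched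
  punched-injective {u} {w} = app-injective π ∘ Fin.punchOut-injective (v∉image u) (v∉image w)

infix 30 _⁻¹

opaque
  _⁻¹ : Perm n → Perm n
  π ⁻¹ = fromInjective (proj₁ ∘ app-surjective π) λ {v} {w} eq →
    trans (sym (proj₂ (app-surjective π v))) (trans (cong (app π) eq) (proj₂ (app-surjective π w)))

  app-⁻¹ʳ : (π : Perm n) (v : Fin n) → app π (app (π ⁻¹) v) ≡ v
  app-⁻¹ʳ π v =
    trans (cong (app π) (lookup∘tabulate (proj₁ ∘ app-surjective π) v)) (proj₂ (app-surjective π v))

app-⁻¹ˡ : (π : Perm n) (u : Fin n) → app (π ⁻¹) (app π u) ≡ u
app-⁻¹ˡ π u = app-injective π (app-⁻¹ʳ π (app π u))

∘-inverseʳ : (π : Perm n) → π ∘ₚ π ⁻¹ ≡ idP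
∘-inverseʳ π = perm-ext λ v → trans (app-∘ π (π ⁻¹) v) (trans (app-⁻¹ʳ π v) (sym (app-idP v)))

inverse-unique : {π ρ : Perm n} → π ∘ₚ ρ ≡ idP → ρ ≡ π ⁻¹
inverse-unique {π = π} {ρ} πρ≡id = perm-ext λ v → begin
  app ρ v                       ≡⟨ app-⁻¹ˡ π (app ρ v) ⟨
  app (π ⁻¹) (app π (app ρ v))  ≡⟨ cong (app (π ⁻¹)) (app-∘ π ρ v) ⟨
  app (π ⁻¹) (app (π ∘ₚ ρ) v)   ≡⟨ cong (λ σ → app (π ⁻¹) (app σ v)) πρ≡id ⟩
  app (π ⁻¹) (app idP v)        ≡⟨ cong (app (π ⁻¹)) (app-idP v) ⟩
  app (π ⁻¹) v                  ∎
  where open ≡-Reasoning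

sameOrder⇒∘⁻¹-increasing : {f : Fin n → Fin b} (σ : Perm n) → SameOrder f (app σ) →
  Increasing (f ∘ app (σ ⁻¹))
sameOrder⇒∘⁻¹-increasing σ o u v u<v =
  from (o _ _) (subst₂ _<_ (sym (app-⁻¹ʳ σ u)) (sym (app-⁻¹ʳ σ v)) u<v)

-- τ σ⁻¹ is increasing, hence moves no point down.
sameOrder⇒≤ : {σ τ : Perm n} → SameOrder (app σ) (app τ) → ∀ i → toℕ (app σ i) ≤ toℕ (app τ i)
sameOrder⇒≤ {σ = σ} {τ} o i = subst (λ k → toℕ (app σ i) ≤ toℕ (app τ k)) (app-⁻¹ˡ σ i)
  (increasing-≥ _ (sameOrder⇒∘⁻¹-increasing σ (sameOrder-sym o)) (app σ i))

sameOrder⇒≡ : {σ τ : Perm n} → SameOrder (app σ) (app τ) → σ ≡ τ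
sameOrder⇒≡ {σ = σ} {τ} o = perm-ext λ i → Fin.toℕ-injective
  (ℕ.≤-antisym (sameOrder⇒≤ {σ = σ} {τ} o i) (sameOrder⇒≤ {σ = τ} {σ} (sameOrder-sym o) i))

module Standardisation {N : ℕ} (f : Fin a → Fin N) (f-inj : Injective _≡_ _≡_ f) where

  below : Fin a → Subset a
  below j = tabulate λ k → isYes (f k <? f j)

  ∈-below : ∀ j k → k ∈ below j ⇔ f k < f j
  ∈-below j k = mk⇔
    (λ k∈ → toWitness {a? = f k <? f j} (from T-≡ (trans (sym (lookup∘tabulate _ k)) ([]=⇒lookup k∈))))
    (λ fk<fj → lookup⇒[]= k _ (trans (lookup∘tabulate _ k) (to T-≡ (fromWitness fk<fj))))

  ∉-below-self : ∀ j → j ∉ below j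
  ∉-below-self j j∈ = Fin.<-irrefl refl (to (∈-below j j) j∈)

  rank : Fin a → ℕ
  rank j = ∣ below j ∣

  rank-< : ∀ j → rank j ℕ.< a
  rank-< j = subst (rank j ℕ.<_) (∣⊤∣≡n a) (p⊂q⇒∣p∣<∣q∣ (⊆⊤ , j , ∈⊤ , ∉-below-self j))

  rank-mono : ∀ j k → f j < f k → rank j ℕ.< rank k
  rank-mono j k fj<fk = p⊂q⇒∣p∣<∣q∣ (below-⊆ , j , from (∈-below k j) fj<fk , ∉-below-self j)
    where
    below-⊆ : ∀ {x} → x ∈ below j → x ∈ below k
    below-⊆ {x} x∈ = from (∈-below k x) (Fin.<-trans (to (∈-below j x) x∈) fj<fk)

  standardised : Fin a → Fin a
  standardised j = fromℕ< (rank-< j)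

  sameOrder-standardised : SameOrder f standardised
  sameOrder-standardised = monotone⇒sameOrder f-inj λ j k fj<fk →
    subst₂ ℕ._<_ (sym (Fin.toℕ-fromℕ< (rank-< j))) (sym (Fin.toℕ-fromℕ< (rank-< k))) (rank-mono j k fj<fk)

  opaque
    standardise : Perm a
    standardise = fromInjective standardised (sameOrder-injective f-inj sameOrder-standardised)

    sameOrder-standardise : SameOrder f (app standardise)
    sameOrder-standardise =
      sameOrder-trans sameOrder-standardised (≗⇒sameOrder (sym ∘ lookup∘tabulate standardised))

open Standardisation using (standardise; sameOrder-standardise)

∃-∉-image : ℓ ℕ.< n → (ι : Fin ℓ → Fin n) → ∃ λ p → ∀ j → p ≢ ι j
∃-∉-image {n = n} ℓ<n ι =
  Product.map₂ (λ p∉ j p≡ιj → p∉ (j , sym p≡ιj))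
    (Fin.¬∀⟶∃¬ n _ (λ p → Fin.any? λ j → ι j ≟ p) ¬surjective)
  where
  ¬surjective : ¬ (∀ p → ∃ λ j → ι j ≡ p)
  ¬surjective hit = ℕ.<⇒≱ ℓ<n (Fin.injective⇒≤ {f = proj₁ ∘ hit} λ {p} {q} eq →
    trans (sym (proj₂ (hit p))) (trans (cong ι eq) (proj₂ (hit q))))

punchIn-increasing : (p : Fin (suc n)) → Increasing (punchIn p)
punchIn-increasing p j k j<k = Fin.≤∧≢⇒<
  (Fin.punchIn-mono-≤ p j k (ℕ.<⇒≤ j<k))
  (Fin.<⇒≢ j<k ∘ Fin.punchIn-injective p j k)

punchOut-increasing : {p : Fin (suc n)} {ι : Fin ℓ → Fin (suc n)} → Increasing ι →
  (p∉ : ∀ j → p ≢ ι j) → Increasing (λ j → punchOut (p∉ j))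
punchOut-increasing ι↑ p∉ j k j<k = Fin.≤∧≢⇒<
  (Fin.punchOut-mono-≤ (p∉ j) (p∉ k) (ℕ.<⇒≤ (ι↑ j k j<k)))
  (Fin.<⇒≢ (ι↑ j k j<k) ∘ Fin.punchOut-injective (p∉ j) (p∉ k))

open SameOrder-Reasoning

patternAt : (π : Perm n) (ι : Fin ℓ → Fin n) → Increasing ι → Perm ℓ
patternAt π ι ι↑ = standardise (app π ∘ ι) (increasing-injective ι↑ ∘ app-injective π)

sameOrder-patternAt : (π : Perm n) {ι : Fin ℓ → Fin n} (ι↑ : Increasing ι) →
  SameOrder (app π ∘ ι) (app (patternAt π ι ι↑))
sameOrder-patternAt π {ι} ι↑ =
  sameOrder-standardise (app π ∘ ι) (increasing-injective ι↑ ∘ app-injective π)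

patternAt-isPatternOf : (π : Perm n) {ι : Fin ℓ → Fin n} (ι↑ : Increasing ι) →
  IsPatternOf (patternAt π ι ι↑) π
patternAt-isPatternOf π {ι} ι↑ = ι , ι↑ , sameOrder-patternAt π ι↑

isPatternOf-refl : (π : Perm n) → IsPatternOf π π
isPatternOf-refl π = id , (λ _ _ j<k → j<k) , (app π ∎)

isPatternOf-trans : {σ : Perm ℓ} {ρ : Perm m} {τ : Perm n} →
  IsPatternOf σ ρ → IsPatternOf ρ τ → IsPatternOf σ τ
isPatternOf-trans {σ = σ} {ρ} {τ} (ε , ε↑ , ρε~σ) (κ , κ↑ , τκ~ρ) =
  κ ∘ ε , (λ j k → κ↑ (ε j) (ε k) ∘ ε↑ j k) ,
  (app τ ∘ κ ∘ ε ~⟨ sameOrder-∘ ε τκ~ρ ⟩ app ρ ∘ ε ~⟨ ρε~σ ⟩ app σ ∎)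

isPatternOf-idP : {σ : Perm ℓ} → IsPatternOf σ (idP {n}) → σ ≡ idP
isPatternOf-idP {σ = σ} (ι , ι↑ , o) = sameOrder⇒≡
  (app σ             ~⟨ o ⟨
   app idP ∘ ι       ≗⟨ app-idP ∘ ι ⟩
   ι                 ~⟨ increasing⇒sameOrder ι↑ ⟨
   id                ≗⟨ sym ∘ app-idP ⟩
   app idP           ∎)

isPatternOf-∘ : {σ : Perm ℓ} (α β : Perm n) → IsPatternOf σ (α ∘ₚ β) →
  ∃₂ λ q p → IsPatternOf q α × IsPatternOf p β × σ ≡ q ∘ₚ p
isPatternOf-∘ {σ = σ} α β (ι , ι↑ , o) =
  q , p , patternAt-isPatternOf α ι₂↑ , patternAt-isPatternOf β ι↑ , σ≡qp
  where
  p = patternAt β ι ι↑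
  -- the positions β(ι j), in increasing order
  ι₂ = app β ∘ ι ∘ app (p ⁻¹)
  ι₂↑ : Increasing ι₂
  ι₂↑ = sameOrder⇒∘⁻¹-increasing p (sameOrder-patternAt β ι↑)
  q = patternAt α ι₂ ι₂↑
  σ≡qp : σ ≡ q ∘ₚ p
  σ≡qp = sameOrder⇒≡
    (app σ                ~⟨ o ⟨
     app (α ∘ₚ β) ∘ ι     ≗⟨ (λ j → trans (app-∘ α β (ι j)) (cong (app α ∘ app β ∘ ι) (sym (app-⁻¹ˡ p j)))) ⟩
     app α ∘ ι₂ ∘ app p   ~⟨ sameOrder-∘ (app p) (sameOrder-patternAt α ι₂↑) ⟩
     app q ∘ app p        ≗⟨ sym ∘ app-∘ q p ⟩
     app (q ∘ₚ p)         ∎)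

isPatternOf-⁻¹ : {σ : Perm ℓ} {π : Perm n} → IsPatternOf σ π → IsPatternOf (σ ⁻¹) (π ⁻¹)
isPatternOf-⁻¹ {σ = σ} {π} (ι , ι↑ , o) = ι′ , sameOrder⇒∘⁻¹-increasing σ o ,
  (app (π ⁻¹) ∘ ι′      ≗⟨ app-⁻¹ˡ π ∘ ι ∘ app (σ ⁻¹) ⟩
   ι ∘ app (σ ⁻¹)       ~⟨ sameOrder-∘ (app (σ ⁻¹)) (increasing⇒sameOrder ι↑) ⟨
   app (σ ⁻¹)           ∎)
  where
  ι′ = app π ∘ ι ∘ app (σ ⁻¹)

-- Delete from τ a point not used by the given occurrence of σ.
isPatternOf-delete : {σ : Perm ℓ} {τ : Perm (suc n)} → ℓ ≤ n → IsPatternOf σ τ →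
  Σ (Perm n) λ τ′ → IsPatternOf τ′ τ × IsPatternOf σ τ′
isPatternOf-delete {ℓ} {σ = σ} {τ} ℓ≤n (ι , ι↑ , o) with ∃-∉-image (s≤s ℓ≤n) ι
... | p , p∉ = τ′ , patternAt-isPatternOf τ (punchIn-increasing p) , ι′ , punchOut-increasing ι↑ p∉ ,
  (app τ′ ∘ ι′               ~⟨ sameOrder-∘ ι′ (sameOrder-patternAt τ (punchIn-increasing p)) ⟨
   app τ ∘ punchIn p ∘ ι′    ≗⟨ cong (app τ) ∘ Fin.punchIn-punchOut ∘ p∉ ⟩
   app τ ∘ ι                 ~⟨ o ⟩
   app σ                     ∎)
  where
  τ′ = patternAt τ (punchIn p) (punchIn-increasing p)
  ι′ : Fin ℓ → Fin _
  ι′ j = punchOut (p∉ j)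

interpolate : {σ : Perm ℓ} {τ : Perm n} → ℓ ≤ m → m ≤ n → IsPatternOf σ τ →
  Σ (Perm m) λ ρ → IsPatternOf ρ τ × IsPatternOf σ ρ
interpolate {σ = σ} {τ} ℓ≤m m≤n σ≼τ with ℕ.m≤n⇒m<n∨m≡n m≤n
... | inj₂ refl = τ , isPatternOf-refl τ , σ≼τ
... | inj₁ (s≤s m≤n′) with isPatternOf-delete {σ = σ} {τ} (ℕ.≤-trans ℓ≤m m≤n′) σ≼τ
...   | τ′ , τ′≼τ , σ≼τ′ with interpolate {σ = σ} {τ = τ′} ℓ≤m m≤n′ σ≼τ′
...     | ρ , ρ≼τ′ , σ≼ρ = ρ , isPatternOf-trans {σ = ρ} {ρ = τ′} {τ = τ} ρ≼τ′ τ′≼τ , σ≼ρ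

Comp-isSubgroup : {G : PSet ℓ} → IsSubgroup G → IsSubgroup (Comp n G)
Comp-isSubgroup {n = n} {G} G-subgroup = record
  { has-id   = has-id′
  ; closed∘  = closed∘′
  ; closed⁻¹ = closed⁻¹′
  }
  where
  open IsSubgroup G-subgroup

  has-id′ : Comp n G idP
  has-id′ σ σ≼id = subst G (sym (isPatternOf-idP {σ = σ} σ≼id)) has-id

  closed∘′ : ∀ α β → Comp n G α → Comp n G β → Comp n G (α ∘ₚ β)
  closed∘′ α β α∈ β∈ σ σ≼αβ =
    let q , p , q≼α , p≼β , σ≡qp = isPatternOf-∘ {σ = σ} α β σ≼αβ
    in subst G (sym σ≡qp) (closed∘ q p (α∈ q q≼α) (β∈ p p≼β))

  closed⁻¹′ : ∀ π ρ → Comp n G ρ → π ∘ₚ ρ ≡ idP → Comp n G π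
  closed⁻¹′ π ρ ρ∈ πρ≡id σ σ≼π = closed⁻¹ σ (σ ⁻¹) (ρ∈ (σ ⁻¹) σ⁻¹≼ρ) (∘-inverseʳ σ)
    where
    σ⁻¹≼ρ : IsPatternOf (σ ⁻¹) ρ
    σ⁻¹≼ρ = subst (IsPatternOf (σ ⁻¹)) (sym (inverse-unique {π = π} {ρ} πρ≡id)) (isPatternOf-⁻¹ {σ = σ} {π} σ≼π)

⊆ₚ-trans : {A B C : PSet n} → A ⊆ₚ B → B ⊆ₚ C → A ⊆ₚ C
⊆ₚ-trans A⊆B B⊆C π = B⊆C π ∘ A⊆B π

⟨⟩-isSubgroup : {A : PSet n} → IsSubgroup ⟨ A ⟩
⟨⟩-isSubgroup = record { has-id = one ; closed∘ = λ _ _ → mul ; closed⁻¹ = λ _ _ → inv }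

⟨⟩-least : {A B : PSet n} → A ⊆ₚ B → IsSubgroup B → ⟨ A ⟩ ⊆ₚ B
⟨⟩-least A⊆B B-subgroup π (gen π∈A) = A⊆B π π∈A
⟨⟩-least A⊆B B-subgroup _ one = IsSubgroup.has-id B-subgroup
⟨⟩-least A⊆B B-subgroup _ (mul {σ} {τ} σ∈ τ∈) =
  IsSubgroup.closed∘ B-subgroup σ τ (⟨⟩-least A⊆B B-subgroup σ σ∈) (⟨⟩-least A⊆B B-subgroup τ τ∈)
⟨⟩-least A⊆B B-subgroup π (inv {ρ = ρ} ρ∈ πρ≡id) =
  IsSubgroup.closed⁻¹ B-subgroup π ρ (⟨⟩-least A⊆B B-subgroup ρ ρ∈) πρ≡id

⟨⟩-mono : {A B : PSet n} → A ⊆ₚ B → ⟨ A ⟩ ⊆ₚ ⟨ B ⟩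
⟨⟩-mono A⊆B = ⟨⟩-least (λ π → gen ∘ A⊆B π) ⟨⟩-isSubgroup

⟨⟩-idempotent : {A : PSet n} → ⟨ ⟨ A ⟩ ⟩ ⊆ₚ ⟨ A ⟩
⟨⟩-idempotent = ⟨⟩-least (λ _ π∈ → π∈) ⟨⟩-isSubgroup

Comp-mono : {S S′ : PSet ℓ} → S ⊆ₚ S′ → Comp n S ⊆ₚ Comp n S′
Comp-mono S⊆S′ τ τ∈ σ σ≼τ = S⊆S′ σ (τ∈ σ σ≼τ)

Pat-mono : {T T′ : PSet n} → T ⊆ₚ T′ → Pat ℓ T ⊆ₚ Pat ℓ T′
Pat-mono T⊆T′ σ (τ , τ∈ , σ≼τ) = τ , T⊆T′ τ τ∈ , σ≼τ

-- ⟨ A ⟩ lies in the subgroup Comp n ⟨ Pat ℓ A ⟩.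
Pat-⟨⟩ : (A : PSet n) → Pat ℓ ⟨ A ⟩ ⊆ₚ ⟨ Pat ℓ A ⟩
Pat-⟨⟩ A σ (τ , τ∈ , σ≼τ) =
  ⟨⟩-least (λ π π∈ ρ ρ≼π → gen (π , π∈ , ρ≼π)) (Comp-isSubgroup ⟨⟩-isSubgroup) τ τ∈ σ σ≼τ

module _ (ℓ≤m : ℓ ≤ m) (m≤n : m ≤ n) where

  Comp-Comp : (S : PSet ℓ) → Comp n (Comp m S) ≐ Comp n S
  Comp-Comp S = Comp-Comp⊆ , λ τ τ∈ ρ ρ≼τ σ σ≼ρ → τ∈ σ (isPatternOf-trans {σ = σ} {ρ} {τ} σ≼ρ ρ≼τ)
    where
    Comp-Comp⊆ : Comp n (Comp m S) ⊆ₚ Comp n S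
    Comp-Comp⊆ τ τ∈ σ σ≼τ with interpolate {σ = σ} {τ} ℓ≤m m≤n σ≼τ
    ... | ρ , ρ≼τ , σ≼ρ = τ∈ ρ ρ≼τ σ σ≼ρ

  Pat-Pat : (T : PSet n) → Pat ℓ (Pat m T) ≐ Pat ℓ T
  Pat-Pat T = Pat-Pat⊆ , Pat-Pat⊇
    where
    Pat-Pat⊆ : Pat ℓ (Pat m T) ⊆ₚ Pat ℓ T
    Pat-Pat⊆ σ (ρ , (τ , τ∈ , ρ≼τ) , σ≼ρ) = τ , τ∈ , isPatternOf-trans {σ = σ} {ρ} {τ} σ≼ρ ρ≼τ
    Pat-Pat⊇ : Pat ℓ T ⊆ₚ Pat ℓ (Pat m T)
    Pat-Pat⊇ σ (τ , τ∈ , σ≼τ) with interpolate {σ = σ} {τ} ℓ≤m m≤n σ≼τ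
    ... | ρ , ρ≼τ , σ≼ρ = ρ , (τ , τ∈ , ρ≼τ) , σ≼ρ

  CompBar-CompBar : {G : PSet ℓ} → IsSubgroup G → CompBar n (CompBar m G) ≐ CompBar n G
  CompBar-CompBar {G} G-subgroup =
    ⟨⟩-mono (⊆ₚ-trans (Comp-mono (⟨⟩-least (λ _ ρ∈ → ρ∈) (Comp-isSubgroup G-subgroup))) (proj₁ (Comp-Comp G))) ,
    ⟨⟩-mono (⊆ₚ-trans (proj₂ (Comp-Comp G)) (Comp-mono (λ _ → gen)))

  PatBar-PatBar : (H : PSet n) → PatBar ℓ (PatBar m H) ≐ PatBar ℓ H
  PatBar-PatBar H =
    ⊆ₚ-trans (⟨⟩-mono (Pat-⟨⟩ (Pat m H))) (⊆ₚ-trans ⟨⟩-idempotent (⟨⟩-mono (proj₁ (Pat-Pat H)))) ,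
    ⟨⟩-mono (⊆ₚ-trans (proj₂ (Pat-Pat H)) (Pat-mono (λ _ → gen)))

lemma2p5 : (ℓ m n : ℕ) → 1 ≤ ℓ → ℓ ≤ m → m ≤ n →
    ((S : PSet ℓ) → Comp n (Comp m S) ≐ Comp n S) ×
    ((T : PSet n) → Pat ℓ (Pat m T) ≐ Pat ℓ T) ×
    ((G : PSet ℓ) → IsSubgroup G → CompBar n (CompBar m G) ≐ CompBar n G) ×
    ((H : PSet n) → IsSubgroup H → PatBar ℓ (PatBar m H) ≐ PatBar ℓ H)
lemma2p5 ℓ m n _ ℓ≤m m≤n =
  Comp-Comp ℓ≤m m≤n ,
  Pat-Pat ℓ≤m m≤n ,
  (λ G → CompBar-CompBar ℓ≤m m≤n) ,
  (λ H _ → PatBar-PatBar ℓ≤m m≤n H)
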